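{- Let $G$ be a graph. Then $\kappa(B(G))\ge\kappa(G)$.
   Context: All graphs are finite, simple and undirected; $\kappa$ denotes the (vertex) connectivity number. For a graph $G$ on vertices $v_1,\dots,v_n$, the bipartite graph $B(G)$ has vertex set $\{v_{i,1},v_{i,2}: i\in[n]\}$; for every $i\in[n]$ the vertices $v_{i,1}$ and $v_{i,2}$ are adjacent, and for every edge $v_iv_j\in E(G)$ the edges $v_{i,1}v_{j,2}$ and $v_{i,2}v_{j,1}$ are present; there are no other edges. -}

module Defs where

open import Data.Nat using (ℕ; suc; _+_; _<_; _≤_)
open import Data.Fin using (Fin; splitAt; _≟_)
open import Data.Fin.Subset using (Subset; _∉_; ∣_∣)
open import Data.Bool using (Bool; true; false; _∨_)
open import Data.Sum using (inj₁; inj₂)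
open import Data.Product using (_×_)
open import Relation.Nullary using (¬_)
open import Relation.Nullary.Decidable using (⌊_⌋)
open import Relation.Binary.PropositionalEquality using (_≡_)

Graph : ℕ → Set
Graph n = Fin n → Fin n → Bool

IsSimple : ∀ {n} → Graph n → Set
IsSimple {n} G = (∀ (i j : Fin n) → G i j ≡ G j i) × (∀ (i : Fin n) → G i i ≡ false)

data Reach {n} (G : Graph n) (X : Subset n) (u : Fin n) : Fin n → Set where
  here : u ∉ X → Reach G X u u
  step : ∀ {v w} → Reach G X u v → G v w ≡ true → w ∉ X → Reach G X u w

KConnected : ∀ {n} → Graph n → ℕ → Set
KConnected {n} G k =
  (k < n) × (∀ (X : Subset n) → ∣ X ∣ < k → ∀ (u v : Fin n) → u ∉ X → v ∉ X → Reach G X u v)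

-- κ(G) = k : k is the greatest integer such that G is k-connected
-- (k-connectivity is downward closed in k).
IsConnectivity : ∀ {n} → Graph n → ℕ → Set
IsConnectivity G k = KConnected G k × ¬ KConnected G (suc k)

-- B(G): vertex set Fin (n + n); v_{i,1} is  i ↑ˡ n  (first block), v_{i,2} is  n ↑ʳ i  (second block).
-- v_{i,1} ~ v_{j,2} iff i = j or v_i v_j ∈ E(G); no edges inside a block.
B : ∀ {n} → Graph n → Graph (n + n)
B {n} G x y with splitAt n x | splitAt n y
... | inj₁ i | inj₂ j = ⌊ i ≟ j ⌋ ∨ G i j
... | inj₂ i | inj₁ j = ⌊ i ≟ j ⌋ ∨ G i j
... | inj₁ _ | inj₁ _ = false
... | inj₂ _ | inj₂ _ = false

-- Write Y for the set of indices i such that v_{i,1} or v_{i,2} lies in a separator X of B(G);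
-- then |Y| ≤ |X| < κ(G), so G − Y is connected. A walk of G − Y lifts to B(G) − X by alternating
-- between the two copies of its vertices, and every vertex v_{i,s} of B(G) − X is joined to a
-- lifted vertex: directly if i ∉ Y, and otherwise through a neighbour j ∉ Y of i, which exists
-- because G − (Y − i) is still connected.
module Submission where

open import Defs
open import Data.Nat using (ℕ; suc; _+_; _≤_; _<_; s≤s; z≤n)
open import Data.Nat.Properties
  using (≤-trans; ≤-reflexive; <-trans; ≤-<-trans; <-≤-trans; n≤1+n; +-suc; +-monoʳ-≤; m≤m+n; <⇒≱; ≮⇒≥)
open import Data.Bool using (true; _∨_)
open import Data.Bool.Properties using (∨-zeroʳ)
open import Data.Fin using (Fin; zero; suc; splitAt; _≟_; _↑ˡ_; _↑ʳ_)
open import Data.Fin.Properties using (splitAt-↑ˡ; splitAt-↑ʳ; splitAt⁻¹-↑ˡ; splitAt⁻¹-↑ʳ; ¬∀⟶∃¬)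
open import Data.Fin.Subset using (Subset; _∈_; _∉_; ∣_∣; _∪_; _-_; ⁅_⁆; ⊤; inside; outside)
open import Data.Fin.Subset.Properties
  using (_∈?_; ∣⊤∣≡n; p⊆q⇒∣p∣≤∣q∣; p─q⊆p; ∣p─q∣≤∣p∣; x∈p∧x≢y⇒x∈p-y; x∈p∪q⁺)
open import Data.Vec using ([]; _∷_; _++_; there)
import Data.Vec as Vec
open import Data.Vec.Properties using ([]=⇒lookup; lookup⇒[]=; lookup-++ˡ; lookup-++ʳ)
open import Data.Sum using (inj₁; inj₂)
open import Data.Product using (_×_; _,_; proj₁; ∃-syntax)
open import Function using (_∘_)
open import Relation.Nullary using (yes; no; contradiction)
open import Relation.Nullary.Decidable using (⌊_⌋)
open import Relation.Binary.PropositionalEquality using (_≡_; refl; sym; trans; cong; cong₂; subst)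

x∉p-x : ∀ {n} (p : Subset n) x → x ∉ p - x
x∉p-x (_ ∷ p) zero    ()
x∉p-x (_ ∷ p) (suc x) (there x∈p-x) = x∉p-x p x x∈p-x

∣p∪q∣≤∣p∣+∣q∣ : ∀ {n} (p q : Subset n) → ∣ p ∪ q ∣ ≤ ∣ p ∣ + ∣ q ∣
∣p∪q∣≤∣p∣+∣q∣ []            []            = z≤n
∣p∪q∣≤∣p∣+∣q∣ (inside  ∷ p) (inside  ∷ q) =
  s≤s (≤-trans (∣p∪q∣≤∣p∣+∣q∣ p q) (+-monoʳ-≤ ∣ p ∣ (n≤1+n ∣ q ∣)))
∣p∪q∣≤∣p∣+∣q∣ (inside  ∷ p) (outside ∷ q) = s≤s (∣p∪q∣≤∣p∣+∣q∣ p q)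
∣p∪q∣≤∣p∣+∣q∣ (outside ∷ p) (inside  ∷ q) =
  ≤-trans (s≤s (∣p∪q∣≤∣p∣+∣q∣ p q)) (≤-reflexive (sym (+-suc ∣ p ∣ ∣ q ∣)))
∣p∪q∣≤∣p∣+∣q∣ (outside ∷ p) (outside ∷ q) = ∣p∪q∣≤∣p∣+∣q∣ p q

∣p++q∣≡∣p∣+∣q∣ : ∀ {m n} (p : Subset m) (q : Subset n) → ∣ p ++ q ∣ ≡ ∣ p ∣ + ∣ q ∣
∣p++q∣≡∣p∣+∣q∣ []            q = refl
∣p++q∣≡∣p∣+∣q∣ (inside  ∷ p) q = cong suc (∣p++q∣≡∣p∣+∣q∣ p q)
∣p++q∣≡∣p∣+∣q∣ (outside ∷ p) q = ∣p++q∣≡∣p∣+∣q∣ p q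

∃-∉ : ∀ {n} (p : Subset n) → ∣ p ∣ < n → ∃[ x ] x ∉ p
∃-∉ {n} p ∣p∣<n = ¬∀⟶∃¬ n (_∈ p) (_∈? p) λ all∈p →
  <⇒≱ ∣p∣<n (subst (_≤ ∣ p ∣) (∣⊤∣≡n n) (p⊆q⇒∣p∣≤∣q∣ {p = ⊤} (λ {x} _ → all∈p x)))

module _ {m n} (p : Subset m) (q : Subset n) where

  ↑ˡ∈p++q⇒∈p : ∀ {i} → i ↑ˡ n ∈ p ++ q → i ∈ p
  ↑ˡ∈p++q⇒∈p {i} i∈ = lookup⇒[]= i p (trans (sym (lookup-++ˡ p q i)) ([]=⇒lookup i∈))

  ↑ʳ∈p++q⇒∈q : ∀ {i} → m ↑ʳ i ∈ p ++ q → i ∈ q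
  ↑ʳ∈p++q⇒∈q {i} i∈ = lookup⇒[]= i q (trans (sym (lookup-++ʳ p q i)) ([]=⇒lookup i∈))

data Copy {n} : Fin (n + n) → Set where
  first  : ∀ i → Copy (i ↑ˡ n)
  second : ∀ i → Copy (n ↑ʳ i)

copy : ∀ {n} (x : Fin (n + n)) → Copy x
copy {n} x with splitAt n x in eq
... | inj₁ i = subst Copy (splitAt⁻¹-↑ˡ eq) (first i)
... | inj₂ i = subst Copy (splitAt⁻¹-↑ʳ eq) (second i)

module _ {n} {G : Graph n} {X : Subset n} where

  reach-target∉ : ∀ {u v} → Reach G X u v → v ∉ X
  reach-target∉ (here v∉X)     = v∉X
  reach-target∉ (step _ _ v∉X) = v∉X

  reach-trans : ∀ {u v w} → Reach G X u v → Reach G X v w → Reach G X u w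
  reach-trans u⇝v (here _)         = u⇝v
  reach-trans u⇝v (step v⇝w e w∉X) = step (reach-trans u⇝v v⇝w) e w∉X

  reach-reverse : (∀ i j → G i j ≡ G j i) → ∀ {u v} → Reach G X u v → Reach G X v u
  reach-reverse G-sym (here u∉X) = here u∉X
  reach-reverse G-sym (step {v} {w} u⇝v e w∉X) =
    reach-trans (step (here w∉X) (trans (G-sym w v) e) (reach-target∉ u⇝v)) (reach-reverse G-sym u⇝v)

-- The walk avoids every vertex of Y except i, so it can only leave Y directly from i.
neighbour-on-exit : ∀ {n} {G : Graph n} {Y : Subset n} {i w} →
  i ∈ Y → Reach G (Y - i) i w → w ∉ Y → ∃[ j ] G i j ≡ true × j ∉ Y
neighbour-on-exit i∈Y (here _) i∉Y = contradiction i∈Y i∉Y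
neighbour-on-exit {Y = Y} {i} i∈Y (step {v} {w} i⇝v e _) w∉Y with v ∈? Y
... | no v∉Y = neighbour-on-exit i∈Y i⇝v v∉Y
... | yes v∈Y with v ≟ i
...   | yes refl = w , e , w∉Y
...   | no v≢i   = contradiction (x∈p∧x≢y⇒x∈p-y v∈Y v≢i) (reach-target∉ i⇝v)

KConnected⇒∃neighbour∉ : ∀ {n} {G : Graph n} {k} → KConnected G k →
  ∀ {Y} → ∣ Y ∣ < k → ∀ {i} → i ∈ Y → ∃[ j ] G i j ≡ true × j ∉ Y
KConnected⇒∃neighbour∉ (k<n , conn) {Y} ∣Y∣<k {i} i∈Y with ∃-∉ Y (<-trans ∣Y∣<k k<n)
... | c , c∉Y = neighbour-on-exit i∈Y (conn (Y - i) ∣Y-i∣<k i c (x∉p-x Y i) (c∉Y ∘ p─q⊆p Y ⁅ i ⁆)) c∉Y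
  where ∣Y-i∣<k = ≤-<-trans (∣p─q∣≤∣p∣ Y ⁅ i ⁆) ∣Y∣<k

KConnected-≤ : ∀ {n} {G : Graph n} {j k} → j ≤ k → KConnected G k → KConnected G j
KConnected-≤ j≤k (k<n , conn) = ≤-<-trans j≤k k<n , λ X ∣X∣<j → conn X (<-≤-trans ∣X∣<j j≤k)

⌊i≟i⌋ : ∀ {n} (i : Fin n) → ⌊ i ≟ i ⌋ ≡ true
⌊i≟i⌋ i with i ≟ i
... | yes _  = refl
... | no i≢i = contradiction refl i≢i

⌊i≟j⌋≡⌊j≟i⌋ : ∀ {n} (i j : Fin n) → ⌊ i ≟ j ⌋ ≡ ⌊ j ≟ i ⌋
⌊i≟j⌋≡⌊j≟i⌋ i j with i ≟ j | j ≟ i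
... | yes _    | yes _    = refl
... | no _     | no _     = refl
... | yes refl | no i≢i   = contradiction refl i≢i
... | no i≢i   | yes refl = contradiction refl i≢i

module _ {n} (G : Graph n) where

  B-↑ˡ↑ʳ : ∀ i j → B G (i ↑ˡ n) (n ↑ʳ j) ≡ (⌊ i ≟ j ⌋ ∨ G i j)
  B-↑ˡ↑ʳ i j rewrite splitAt-↑ˡ n i n | splitAt-↑ʳ n n j = refl

  B-↑ʳ↑ˡ : ∀ i j → B G (n ↑ʳ i) (j ↑ˡ n) ≡ (⌊ i ≟ j ⌋ ∨ G i j)
  B-↑ʳ↑ˡ i j rewrite splitAt-↑ʳ n n i | splitAt-↑ˡ n j n = refl

  B-sym : (∀ i j → G i j ≡ G j i) → ∀ x y → B G x y ≡ B G y x
  B-sym G-sym x y with splitAt n x | splitAt n y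
  ... | inj₁ i | inj₂ j = cong₂ _∨_ (⌊i≟j⌋≡⌊j≟i⌋ i j) (G-sym i j)
  ... | inj₂ i | inj₁ j = cong₂ _∨_ (⌊i≟j⌋≡⌊j≟i⌋ i j) (G-sym i j)
  ... | inj₁ _ | inj₁ _ = refl
  ... | inj₂ _ | inj₂ _ = refl

  B-rung : ∀ i → B G (i ↑ˡ n) (n ↑ʳ i) ≡ true
  B-rung i = trans (B-↑ˡ↑ʳ i i) (cong (_∨ G i i) (⌊i≟i⌋ i))

  B-rung′ : ∀ i → B G (n ↑ʳ i) (i ↑ˡ n) ≡ true
  B-rung′ i = trans (B-↑ʳ↑ˡ i i) (cong (_∨ G i i) (⌊i≟i⌋ i))

  B-edge : ∀ {i j} → G i j ≡ true → B G (i ↑ˡ n) (n ↑ʳ j) ≡ true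
  B-edge {i} {j} e = trans (B-↑ˡ↑ʳ i j) (trans (cong (⌊ i ≟ j ⌋ ∨_) e) (∨-zeroʳ _))

  B-edge′ : ∀ {i j} → G i j ≡ true → B G (n ↑ʳ i) (j ↑ˡ n) ≡ true
  B-edge′ {i} {j} e = trans (B-↑ʳ↑ˡ i j) (trans (cong (⌊ i ≟ j ⌋ ∨_) e) (∨-zeroʳ _))

module Lifting {n} {G : Graph n} (G-sym : ∀ i j → G i j ≡ G j i)
  (X : Subset (n + n)) (Y : Subset n)
  (↑ˡ∉ : ∀ {c} → c ∉ Y → c ↑ˡ n ∉ X) (↑ʳ∉ : ∀ {c} → c ∉ Y → n ↑ʳ c ∉ X) where

  lift : ∀ {i w} → Reach G Y i w → Reach (B G) X (i ↑ˡ n) (w ↑ˡ n) × Reach (B G) X (i ↑ˡ n) (n ↑ʳ w)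
  lift (here i∉Y) = here (↑ˡ∉ i∉Y) , step (here (↑ˡ∉ i∉Y)) (B-rung G _) (↑ʳ∉ i∉Y)
  lift (step i⇝v e w∉Y) with lift i⇝v
  ... | i⇝v₁ , i⇝v₂ = step i⇝v₂ (B-edge′ G e) (↑ˡ∉ w∉Y) , step i⇝v₁ (B-edge G e) (↑ʳ∉ w∉Y)

  module _ (neighbour∉ : ∀ {i} → i ∈ Y → ∃[ j ] G i j ≡ true × j ∉ Y) where

    anchor : ∀ {x} → x ∉ X → ∃[ c ] c ∉ Y × Reach (B G) X (c ↑ˡ n) x
    anchor {x} x∉X with copy {n} x
    ... | first i with i ∈? Y
    ...   | no i∉Y = i , i∉Y , here x∉X
    ...   | yes i∈Y with neighbour∉ i∈Y
    ...     | j , e , j∉Y =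
      j , j∉Y , step (step (here (↑ˡ∉ j∉Y)) (B-rung G j) (↑ʳ∉ j∉Y)) (B-edge′ G (trans (G-sym j i) e)) x∉X
    anchor x∉X | second i with i ∈? Y
    ...   | no i∉Y = i , i∉Y , step (here (↑ˡ∉ i∉Y)) (B-rung G i) x∉X
    ...   | yes i∈Y with neighbour∉ i∈Y
    ...     | j , e , j∉Y = j , j∉Y , step (here (↑ˡ∉ j∉Y)) (B-edge G (trans (G-sym j i) e)) x∉X

    connect : (∀ u v → u ∉ Y → v ∉ Y → Reach G Y u v) →
      ∀ {u v} → u ∉ X → v ∉ X → Reach (B G) X u v
    connect Y-conn u∉X v∉X with anchor u∉X | anchor v∉X
    ... | c , c∉Y , c⇝u | d , d∉Y , d⇝v =
      reach-trans (reach-reverse (B-sym G G-sym) c⇝u)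
        (reach-trans (proj₁ (lift (Y-conn c d c∉Y d∉Y))) d⇝v)

B-KConnected : ∀ {n} {G : Graph n} → IsSimple G → ∀ {k} → KConnected G k → KConnected (B G) k
B-KConnected {n} {G} (G-sym , _) {k} G-conn@(k<n , conn) = <-≤-trans k<n (m≤m+n n n) , B-conn
  where
  B-conn : ∀ X → ∣ X ∣ < k → ∀ u v → u ∉ X → v ∉ X → Reach (B G) X u v
  B-conn X ∣X∣<k u v with Vec.splitAt n X
  ... | xs , ys , refl = connect (KConnected⇒∃neighbour∉ G-conn ∣Y∣<k) (conn Y ∣Y∣<k)
    where
    Y = xs ∪ ys
    open Lifting G-sym (xs ++ ys) Y
      (λ c∉Y → c∉Y ∘ x∈p∪q⁺ ∘ inj₁ ∘ ↑ˡ∈p++q⇒∈p xs ys)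
      (λ c∉Y → c∉Y ∘ x∈p∪q⁺ ∘ inj₂ ∘ ↑ʳ∈p++q⇒∈q xs ys)
    ∣Y∣<k : ∣ Y ∣ < k
    ∣Y∣<k = ≤-<-trans (∣p∪q∣≤∣p∣+∣q∣ xs ys) (subst (_< k) (∣p++q∣≡∣p∣+∣q∣ xs ys) ∣X∣<k)

proposition4p2 : ∀ (n : ℕ) (G : Graph n) → IsSimple G →
    ∀ (k k′ : ℕ) → IsConnectivity G k → IsConnectivity (B G) k′ → k ≤ k′
proposition4p2 n G simple k k′ (G-conn , _) (_ , ¬B-conn) =
  ≮⇒≥ λ k′<k → ¬B-conn (KConnected-≤ k′<k (B-KConnected simple G-conn))
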